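{- Let $n$ be a natural number such that $v_2(n)\geq 2$ is even. Then $D_{S(n)^*}\geq 3$.
   Context: $\mathbb Z_n=\mathbb Z/n\mathbb Z$; $S(n)^*=\{x^2:x\in\mathbb Z_n\}\setminus\{0\}$. $v_2(n)=r$ means $2^r\mid n$, $2^{r+1}\nmid n$. For $A\subseteq\mathbb Z_n$, a subsequence $T$ of a sequence $(x_1,\dots,x_k)$ in $\mathbb Z_n$, with nonempty index set $I$, is an $A$-weighted zero-sum subsequence if there exist $a_i\in A$ ($i\in I$) with $\sum_{i\in I}a_ix_i=0$. $D_{S(n)^*}$ is the least positive integer $k$ such that every sequence of length $k$ in $\mathbb Z_n$ has an $S(n)^*$-weighted zero-sum subsequence. -}

module Defs where

open import Data.Nat using (ℕ; zero; suc; _+_; _*_; _^_; _≤_; NonZero)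
open import Data.Nat.DivMod using (_%_)
open import Data.Nat.Divisibility using (_∣_)
open import Data.Fin using (Fin; toℕ)
open import Data.Product using (Σ; ∃; _×_)
open import Relation.Binary.PropositionalEquality using (_≡_; _≢_)
open import Relation.Nullary using (¬_)

V₂ : ℕ → ℕ → Set
V₂ n r = (2 ^ r ∣ n) × ¬ (2 ^ suc r ∣ n)

-- Elements of ℤ_n are represented by Fin n (canonical residues 0..n-1).
-- S(n)* = { x² : x ∈ ℤ_n } \ {0}
InSstar : (n : ℕ) → .{{_ : NonZero n}} → Fin n → Set
InSstar n a = (∃ λ (x : Fin n) → (toℕ x * toℕ x) % n ≡ toℕ a) × (toℕ a ≢ 0)

-- weighted sum Σ_{i ∈ I} a_i x_i  (as a natural number; reduced mod n later)
-- I is given as a Boolean-valued indicator; weights are given for all indices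
-- but only used for those in I.
open import Data.Bool using (Bool; true; false; T)
open import Data.Fin.Subset using (Subset; Nonempty; _∈_)
open import Data.Vec using (lookup)

wsum : {k n : ℕ} → Subset k → (Fin k → Fin n) → (Fin k → Fin n) → ℕ
wsum {zero}  I a x = 0
wsum {suc k} I a x with lookup I Fin.zero
... | true  = toℕ (a Fin.zero) * toℕ (x Fin.zero) + wsum {k} (Data.Vec.tail I) (λ i → a (Fin.suc i)) (λ i → x (Fin.suc i))
... | false = wsum {k} (Data.Vec.tail I) (λ i → a (Fin.suc i)) (λ i → x (Fin.suc i))

HasSstarZeroSum : (n : ℕ) → .{{_ : NonZero n}} → {k : ℕ} → (Fin k → Fin n) → Set
HasSstarZeroSum n {k} x =
  Σ (Subset k) λ I → Nonempty I ×
  Σ (Fin k → Fin n) λ a → (∀ i → i ∈ I → InSstar n (a i)) × (wsum I a x % n ≡ 0)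

DProperty : (n : ℕ) → .{{_ : NonZero n}} → ℕ → Set
DProperty n k = (x : Fin k → Fin n) → HasSstarZeroSum n x

-- D_{S(n)*} ≥ m : every positive k with the property satisfies m ≤ k
-- (equivalently, the least such k is ≥ m).
DStarAtLeast : (n : ℕ) → .{{_ : NonZero n}} → ℕ → Set
DStarAtLeast n m = (k : ℕ) → 1 ≤ k → DProperty n k → m ≤ k

-- Write n = 4^k m with m odd. By the Chinese remainder theorem there is y ≡ 1 (mod 4)
-- such that −y is a quadratic non-residue modulo every prime p ∣ m. Then p ∣ s² + y t²
-- forces p ∣ s and p ∣ t, and 4 ∣ s² + y t² forces s and t to be even. Peeling off from
-- the modulus either a prime dividing it exactly once or a square factor p² or 4, one
-- gets that n ∣ s² + y t² implies n ∣ s² and n ∣ t². So in the sequence (1, y) no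
-- combination a · 1 + b · y, b · y or a · 1 with nonzero squares a, b vanishes in ℤ_n;
-- with the sequence (1) this shows that lengths 1 and 2 do not have the zero-sum property.
module Submission where

open import Data.Bool using (true; false)
open import Data.Fin using (Fin; toℕ; fromℕ<) renaming (zero to fzero; suc to fsuc)
open import Data.Fin.Properties
  using (toℕ<n; toℕ-fromℕ<; toℕ-injective; any?; ¬∀⟶∃¬; <⇒notInjective)
open import Data.List using ([]; _∷_)
open import Data.List.Relation.Unary.All using (All; []; _∷_)
open import Data.Nat
open import Data.Nat.Coprimality using (Coprime; coprime-Bézout; coprime-factors)
  renaming (sym to coprime-sym)
open import Data.Nat.Divisibility
open import Data.Nat.DivMod
open import Data.Nat.GCD using (module Bézout)
open import Data.Nat.Induction using (<-rec)
open import Data.Nat.ListAction using (product)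
open import Data.Nat.Primality
open import Data.Nat.Primality.Factorisation using (factorise)
open import Data.Nat.Properties
open import Data.Nat.Tactic.RingSolver
open import Data.Product
open import Data.Sum using (_⊎_; inj₁; inj₂; reduce)
open import Data.Vec using ([]; _∷_; here; there)
open import Relation.Binary.PropositionalEquality
open import Relation.Nullary

open import Defs

form : ℕ → ℕ → ℕ → ℕ
form y s t = s * s + y * (t * t)

Separating : ℕ → ℕ → Set
Separating n y = ∀ s t → n ∣ form y s t → n ∣ s * s × n ∣ t * t

Anisotropic : ℕ → ℕ → Set
Anisotropic p y = ∀ s t → p ∣ form y s t → p ∣ s × p ∣ t

PrimewiseAnisotropic : ℕ → ℕ → Set
PrimewiseAnisotropic m y = ∀ {q} → Prime q → q ∣ m → Anisotropic q y

primewise-anisotropic-∣ : ∀ {d m y} → d ∣ m → PrimewiseAnisotropic m y → PrimewiseAnisotropic d y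
primewise-anisotropic-∣ d∣m aniso qp q∣d = aniso qp (∣-trans q∣d d∣m)

prime∤⇒coprime : ∀ {p n} → Prime p → ¬ p ∣ n → Coprime p n
prime∤⇒coprime pp p∤n (d∣p , d∣n) with prime⇒irreducible pp d∣p
... | inj₁ d≡1 = d≡1
... | inj₂ refl = contradiction d∣n p∤n

prime⇒>1 : ∀ {p} → Prime p → 1 < p
prime⇒>1 {p} pp = nonTrivial⇒n>1 p {{prime⇒nonTrivial pp}}

prime∣prime⇒≡ : ∀ {p q} → Prime q → Prime p → q ∣ p → q ≡ p
prime∣prime⇒≡ qp pp q∣p with prime⇒irreducible pp q∣p
... | inj₁ refl = contradiction qp ¬prime[1]
... | inj₂ q≡p = q≡p

prime-factor : ∀ m → .{{NonTrivial m}} → ∃ λ p → Prime p × p ∣ m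
prime-factor m with factorise m {{nonTrivial⇒nonZero m}}
... | record { factors = [] ; isFactorisation = m≡1 } = contradiction m≡1 (nonTrivial⇒≢1 {m})
... | record { factors = p ∷ ps ; isFactorisation = m≡Πps ; factorsPrime = pp ∷ _ } =
  p , pp , subst (p ∣_) (sym m≡Πps) (m∣m*n (product ps))

even-or-odd : ∀ n → ∃ λ a → n ≡ a * 2 ⊎ n ≡ 1 + a * 2
even-or-odd zero = 0 , inj₁ refl
even-or-odd (suc n) with even-or-odd n
... | a , inj₁ refl = a , inj₂ refl
... | a , inj₂ refl = suc a , inj₁ refl

∤[k*n+r] : ∀ {n} k r → .{{NonZero r}} → r < n → ¬ n ∣ k * n + r
∤[k*n+r] {n} k r r<n n∣ = <⇒≱ r<n (∣⇒≤ (∣m+n∣m⇒∣n n∣ (n∣m*n k)))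

-- In the second Bézout case x t ≡ −1 (mod m), so u = (m − 1) x.
inverse-mod : ∀ {m t} → 1 < m → Coprime t m → ∃₂ λ u k → u * t ≡ 1 + k * m
inverse-mod _ c with coprime-Bézout c
... | Bézout.+- u k 1+km≡ut = u , k , sym 1+km≡ut
inverse-mod {2+ q} {t} (s≤s (s≤s z≤n)) c | Bézout.-+ x (suc k) 1+xt≡km =
  suc q * x , suc q * k + q , +-cancelʳ-≡ (suc q) _ _ (begin
    suc q * x * t + suc q                ≡⟨ expand q x t ⟩
    suc q * (1 + x * t)                  ≡⟨ cong (suc q *_) 1+xt≡km ⟩
    suc q * (suc k * 2+ q)               ≡⟨ collect q k ⟩
    1 + (suc q * k + q) * 2+ q + suc q   ∎)
  where
  open ≡-Reasoning
  expand : ∀ q x t → (1 + q) * x * t + (1 + q) ≡ (1 + q) * (1 + x * t)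
  expand = solve-∀
  collect : ∀ q k → (1 + q) * ((1 + k) * (2 + q)) ≡ 1 + ((1 + q) * k + q) * (2 + q) + (1 + q)
  collect = solve-∀

-- With x A ≡ 1 (mod B), the solution is u + x A (v − u), where −u is represented by (B − 1) u.
chinese-remainder : ∀ {A B} → 1 < B → Coprime A B → ∀ u v →
  ∃ λ y → (∃ λ j → y ≡ u + j * A) × (∃ λ k → y ≡ v + k * B)
chinese-remainder {A} {B@(suc B′)} 1<B c u v with x , k , xA≡ ← inverse-mod 1<B c =
  u + x * w * A , (x * w , refl) , (u + k * w , (begin
    u + x * w * A        ≡⟨ cong (u +_) (reassoc x w A) ⟩
    u + x * A * w        ≡⟨ cong (λ z → u + z * w) xA≡ ⟩
    u + (1 + k * B) * w  ≡⟨ regroup u v B′ k ⟩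
    v + (u + k * w) * B  ∎))
  where
  open ≡-Reasoning
  w = v + B′ * u
  reassoc : ∀ x w A → x * w * A ≡ x * A * w
  reassoc = solve-∀
  regroup : ∀ u v B′ k →
    u + (1 + k * (1 + B′)) * (v + B′ * u) ≡ v + (u + k * (v + B′ * u)) * (1 + B′)
  regroup = solve-∀

module _ {y : ℕ} where

  separating-1 : Separating 1 y
  separating-1 s t _ = 1∣ _ , 1∣ _

  separating-*-square : ∀ {d n} → .{{NonZero d}} →
    (∀ s t → d * d ∣ form y s t → d ∣ s × d ∣ t) → Separating n y → Separating (d * d * n) y
  separating-*-square {d} {n} d∣ sep s t dd∣
    with divides s′ refl , divides t′ refl ← d∣ s t (∣-trans (m∣m*n n) dd∣) =
    let n∣s′²×t′² = sep s′ t′ n∣form′ in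
    scale-square s′ (proj₁ n∣s′²×t′²) , scale-square t′ (proj₂ n∣s′²×t′²)
    where
    instance _ = m*n≢0 d d
    scale-form : ∀ y d a b → (a * d) * (a * d) + y * ((b * d) * (b * d)) ≡ d * d * (a * a + y * (b * b))
    scale-form = solve-∀
    scale : ∀ d a → d * d * (a * a) ≡ a * d * (a * d)
    scale = solve-∀
    n∣form′ : n ∣ form y s′ t′
    n∣form′ = *-cancelˡ-∣ (d * d) (subst (d * d * n ∣_) (scale-form y d s′ t′) dd∣)
    scale-square : ∀ a → n ∣ a * a → d * d * n ∣ a * d * (a * d)
    scale-square a n∣aa = subst (d * d * n ∣_) (scale d a) (*-monoʳ-∣ (d * d) n∣aa)

  separating-*-prime : ∀ {p n} → Prime p → ¬ p ∣ n →
    Anisotropic p y → Separating n y → Separating (p * n) y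
  separating-*-prime {p} {n} pp p∤n aniso sep s t pn∣ =
    combine (square (proj₁ p∣s×t)) (proj₁ n∣s²×t²) ,
    combine (square (proj₂ p∣s×t)) (proj₂ n∣s²×t²)
    where
    p∣s×t = aniso s t (∣-trans (m∣m*n n) pn∣)
    n∣s²×t² = sep s t (∣-trans (n∣m*n p) pn∣)
    square : ∀ {a} → p ∣ a → p ∣ a * a
    square = ∣m⇒∣m*n _
    combine : ∀ {a} → p ∣ a → n ∣ a → p * n ∣ a
    combine {a} p∣a n∣a = coprime-factors (prime∤⇒coprime pp p∤n)
      (*-monoʳ-∣ p n∣a , subst (p * n ∣_) (*-comm a n) (*-monoˡ-∣ n p∣a))

  primewise-anisotropic⇒separating : ∀ m → NonZero m → PrimewiseAnisotropic m y → Separating m y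
  primewise-anisotropic⇒separating = <-rec _ go
    where
    go : ∀ m → (∀ {k} → k < m → NonZero k → PrimewiseAnisotropic k y → Separating k y) →
         NonZero m → PrimewiseAnisotropic m y → Separating m y
    go 1 _ _ _ = separating-1
    go m@(2+ _) rec _ aniso with p , pp , p∣m@(divides m′ m≡m′p) ← prime-factor m with p ∣? m′
    ... | no p∤m′ =
      subst (λ n → Separating n y) (trans (*-comm p m′) (sym m≡m′p))
        (separating-*-prime pp p∤m′ (aniso pp p∣m)
          (rec (quotient-< p∣m {{prime⇒nonTrivial pp}}) (quotient≢0 p∣m)
            (primewise-anisotropic-∣ {y = y} (quotient-∣ p∣m) aniso)))
    ... | yes p∣m′@(divides m″ refl) =
      subst (λ n → Separating n y) (trans (reorder p m″) (sym m≡m′p))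
        (separating-*-square {{prime⇒nonZero pp}}
          (λ s t pp∣ → aniso pp p∣m s t (∣-trans (m∣m*n p) pp∣))
          (rec (<-trans (quotient-< p∣m′ {{prime⇒nonTrivial pp}} {{quotient≢0 p∣m}})
                        (quotient-< p∣m {{prime⇒nonTrivial pp}}))
               (quotient≢0 p∣m′ {{quotient≢0 p∣m}})
               (primewise-anisotropic-∣ {y = y}
                 (∣-trans (quotient-∣ p∣m′) (quotient-∣ p∣m)) aniso)))
      where
      reorder : ∀ p m″ → p * p * m″ ≡ m″ * p * p
      reorder = solve-∀

-- Modulo 4 the form is s² + t², and an odd square is 1 modulo 4.
4∣form⇒even : ∀ w s t → 4 ∣ form (1 + w * 4) s t → 2 ∣ s × 2 ∣ t
4∣form⇒even w s t 4∣ with even-or-odd s | even-or-odd t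
... | a , inj₁ refl | b , inj₁ refl = divides a refl , divides b refl
... | a , inj₁ refl | b , inj₂ refl = contradiction (subst (4 ∣_) (even-odd a b w) 4∣)
  (∤[k*n+r] (a * a + b * b + b + w * (1 + b * 2) * (1 + b * 2)) 1 (s≤s (s≤s z≤n)))
  where
  even-odd : ∀ a b w → a * 2 * (a * 2) + (1 + w * 4) * ((1 + b * 2) * (1 + b * 2))
                     ≡ (a * a + b * b + b + w * (1 + b * 2) * (1 + b * 2)) * 4 + 1
  even-odd = solve-∀
... | a , inj₂ refl | b , inj₁ refl = contradiction (subst (4 ∣_) (odd-even a b w) 4∣)
  (∤[k*n+r] (a * a + a + b * b + w * b * b * 4) 1 (s≤s (s≤s z≤n)))
  where
  odd-even : ∀ a b w → (1 + a * 2) * (1 + a * 2) + (1 + w * 4) * (b * 2 * (b * 2))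
                     ≡ (a * a + a + b * b + w * b * b * 4) * 4 + 1
  odd-even = solve-∀
... | a , inj₂ refl | b , inj₂ refl = contradiction (subst (4 ∣_) (odd-odd a b w) 4∣)
  (∤[k*n+r] (a * a + a + b * b + b + w * (1 + b * 2) * (1 + b * 2)) 2 (s≤s (s≤s (s≤s z≤n))))
  where
  odd-odd : ∀ a b w → (1 + a * 2) * (1 + a * 2) + (1 + w * 4) * ((1 + b * 2) * (1 + b * 2))
                    ≡ (a * a + a + b * b + b + w * (1 + b * 2) * (1 + b * 2)) * 4 + 2
  odd-odd = solve-∀

separating-4^* : ∀ k {m} w → Separating m (1 + w * 4) → Separating (4 ^ k * m) (1 + w * 4)
separating-4^* zero {m} w sep = subst (λ n → Separating n (1 + w * 4)) (sym (*-identityˡ m)) sep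
separating-4^* (suc k) {m} w sep = subst (λ n → Separating n (1 + w * 4)) (sym (*-assoc 4 (4 ^ k) m))
  (separating-*-square {1 + w * 4} {2} {4 ^ k * m} (4∣form⇒even w) (separating-4^* k w sep))

IsSquare : (p : ℕ) → .{{NonZero p}} → Fin p → Set
IsSquare p c = ∃ λ (x : Fin p) → toℕ x * toℕ x % p ≡ toℕ c

[n∸m]²%n≡m²%n : ∀ {m n} .{{_ : NonZero n}} → m ≤ n → (n ∸ m) * (n ∸ m) % n ≡ m * m % n
[n∸m]²%n≡m²%n {m} {n} m≤n = begin
  e * e % n                      ≡⟨ [m+kn]%n≡m%n (e * e) (m * 2) n ⟨
  (e * e + m * 2 * n) % n        ≡⟨ cong (λ z → (e * e + m * 2 * z) % n) (sym m+e≡n) ⟩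
  (e * e + m * 2 * (m + e)) % n  ≡⟨ cong (_% n) (expand m e) ⟩
  (m * m + (m + e) * (m + e)) % n ≡⟨ cong (λ z → (m * m + z * z) % n) m+e≡n ⟩
  (m * m + n * n) % n            ≡⟨ [m+kn]%n≡m%n (m * m) n n ⟩
  m * m % n                      ∎
  where
  open ≡-Reasoning
  e = n ∸ m
  m+e≡n : m + e ≡ n
  m+e≡n = m+[n∸m]≡n m≤n
  expand : ∀ m e → e * e + m * 2 * (m + e) ≡ m * m + (m + e) * (m + e)
  expand = solve-∀

module _ (q : ℕ) where
  private
    p = suc (q * 2)

  small-root : ∀ {x} → x ≤ p → ∃ λ r → r ≤ q × r * r % p ≡ x * x % p
  small-root {x} x≤p with x ≤? q
  ... | yes x≤q = x , x≤q , refl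
  ... | no x≰q = p ∸ x , p∸x≤q , [n∸m]²%n≡m²%n x≤p
    where
    p∸x≤q : p ∸ x ≤ q
    p∸x≤q = begin
      p ∸ x            ≤⟨ ∸-monoʳ-≤ p (≰⇒> x≰q) ⟩
      p ∸ suc q        ≡⟨ cong (_∸ q) (*-comm q 2) ⟩
      q + (q + 0) ∸ q  ≡⟨ m+n∸m≡n q (q + 0) ⟩
      q + 0            ≡⟨ +-identityʳ q ⟩
      q                ∎
      where open ≤-Reasoning

  -- If every residue had a square root, taking one of size at most q would inject
  -- the p = 2q + 1 residues into q + 1 values.
  nonresidue : .{{NonZero q}} → ∃ λ (c : Fin p) → ¬ IsSquare p c
  nonresidue =
    ¬∀⟶∃¬ p (IsSquare p) (λ c → any? λ x → toℕ x * toℕ x % p ≟ toℕ c) ¬all-squares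
    where
    ¬all-squares : ¬ (∀ c → IsSquare p c)
    ¬all-squares root = <⇒notInjective (s≤s (m<m*n q 2 (s≤s (s≤s z≤n)))) f-injective
      where
      shrink : ∀ c → ∃ λ r → r ≤ q × r * r % p ≡ toℕ c
      shrink c with x , x²≡c ← root c with r , r≤q , r²≡x² ← small-root (<⇒≤ (toℕ<n x)) =
        r , r≤q , trans r²≡x² x²≡c
      f : Fin p → Fin (suc q)
      f c = fromℕ< (s≤s (proj₁ (proj₂ (shrink c))))
      f-injective : ∀ {c c′} → f c ≡ f c′ → c ≡ c′
      f-injective {c} {c′} fc≡fc′ = toℕ-injective (begin
        toℕ c       ≡⟨ proj₂ (proj₂ (shrink c)) ⟨
        r * r % p   ≡⟨ cong (λ z → z * z % p) r≡r′ ⟩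
        r′ * r′ % p ≡⟨ proj₂ (proj₂ (shrink c′)) ⟩
        toℕ c′      ∎)
        where
        open ≡-Reasoning
        r = proj₁ (shrink c)
        r′ = proj₁ (shrink c′)
        r≡r′ : r ≡ r′
        r≡r′ = trans (sym (toℕ-fromℕ< _)) (trans (cong toℕ fc≡fc′) (toℕ-fromℕ< _))

  -- y = (p − 1) c, so that −y ≡ c is a non-residue.
  minus-nonresidue : .{{NonZero q}} → ∃ λ y → ∀ x → ¬ p ∣ x * x + y
  minus-nonresidue with c , c-nonsquare ← nonresidue =
    q * 2 * toℕ c , λ x p∣ → c-nonsquare (fromℕ< (m%n<n x p) , square-root x p∣)
    where
    square-root : ∀ x → p ∣ x * x + q * 2 * toℕ c →
      toℕ (fromℕ< (m%n<n x p)) * toℕ (fromℕ< (m%n<n x p)) % p ≡ toℕ c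
    square-root x p∣ = begin
      toℕ (fromℕ< (m%n<n x p)) * toℕ (fromℕ< (m%n<n x p)) % p
        ≡⟨ cong (λ z → z * z % p) (toℕ-fromℕ< (m%n<n x p)) ⟩
      (x % p) * (x % p) % p               ≡⟨ %-distribˡ-* x x p ⟨
      x * x % p                           ≡⟨ [m+kn]%n≡m%n (x * x) (toℕ c) p ⟨
      (x * x + toℕ c * p) % p             ≡⟨ cong (_% p) (regroup (x * x) q (toℕ c)) ⟩
      (x * x + q * 2 * toℕ c + toℕ c) % p ≡⟨ %-remove-+ˡ (toℕ c) p∣ ⟩
      toℕ c % p                           ≡⟨ m<n⇒m%n≡m (toℕ<n c) ⟩
      toℕ c                               ∎
      where
      open ≡-Reasoning
      regroup : ∀ a q c → a + c * (1 + q * 2) ≡ a + q * 2 * c + c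
      regroup = solve-∀

-- Multiplying by an inverse u of t turns p ∣ s² + y t² into p ∣ (u s)² + y.
minus-nonresidue⇒anisotropic : ∀ {p y} → Prime p → (∀ x → ¬ p ∣ x * x + y) → Anisotropic p y
minus-nonresidue⇒anisotropic {p} {y} pp nonres s t p∣ with p ∣? t
... | yes p∣t = reduce (euclidsLemma s s pp p∣s²) , p∣t
  where
  p∣s² : p ∣ s * s
  p∣s² = ∣m+n∣m⇒∣n (subst (p ∣_) (+-comm (s * s) _) p∣) (∣n⇒∣m*n y (∣m⇒∣m*n t p∣t))
... | no p∤t
  with u , k , ut≡ ← inverse-mod (prime⇒>1 pp) (coprime-sym (prime∤⇒coprime pp p∤t)) =
  contradiction
    (∣m+n∣m⇒∣n (subst (p ∣_) scaled (∣n⇒∣m*n (u * u) p∣)) (n∣m*n (y * (k * 2 + k * k * p))))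
    (nonres (u * s))
  where
  open ≡-Reasoning
  distribute : ∀ u s t y → u * u * (s * s + y * (t * t)) ≡ u * s * (u * s) + y * ((u * t) * (u * t))
  distribute = solve-∀
  expand : ∀ a y k p → a * a + y * ((1 + k * p) * (1 + k * p)) ≡ y * (k * 2 + k * k * p) * p + (a * a + y)
  expand = solve-∀
  scaled : u * u * (s * s + y * (t * t)) ≡ y * (k * 2 + k * k * p) * p + (u * s * (u * s) + y)
  scaled = begin
    u * u * (s * s + y * (t * t))                     ≡⟨ distribute u s t y ⟩
    u * s * (u * s) + y * ((u * t) * (u * t))
      ≡⟨ cong (λ z → u * s * (u * s) + y * (z * z)) ut≡ ⟩
    u * s * (u * s) + y * ((1 + k * p) * (1 + k * p))  ≡⟨ expand (u * s) y k p ⟩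
    y * (k * 2 + k * k * p) * p + (u * s * (u * s) + y) ∎

anisotropic-at-odd-prime : ∀ {p} → Prime p → ¬ 2 ∣ p → ∃ (Anisotropic p)
anisotropic-at-odd-prime {p} pp 2∤p with even-or-odd p
... | a , inj₁ refl = contradiction (divides a refl) 2∤p
... | zero , inj₂ refl = contradiction pp ¬prime[1]
... | q@(suc _) , inj₂ refl = map₂ (minus-nonresidue⇒anisotropic pp) (minus-nonresidue q)

anisotropic-transfer : ∀ {p N y y′} j → p ∣ N → y ≡ y′ + j * N →
  Anisotropic p y′ → Anisotropic p y
anisotropic-transfer {p} {N} {y′ = y′} j p∣N refl aniso s t p∣ =
  aniso s t (∣m+n∣m⇒∣n (subst (p ∣_) (split s t y′ j N) p∣) (∣n⇒∣m*n (j * (t * t)) p∣N))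
  where
  split : ∀ s t y′ j N → s * s + (y′ + j * N) * (t * t) ≡ j * (t * t) * N + (s * s + y′ * (t * t))
  split = solve-∀

primewise-anisotropic-*-divisor : ∀ {p m y} → Prime p → p ∣ m →
  PrimewiseAnisotropic m y → PrimewiseAnisotropic (p * m) y
primewise-anisotropic-*-divisor {p} {m} pp p∣m aniso qp q∣pm with euclidsLemma p m qp q∣pm
... | inj₁ q∣p rewrite prime∣prime⇒≡ qp pp q∣p = aniso pp p∣m
... | inj₂ q∣m = aniso qp q∣m

odd-prime∤*4 : ∀ {p m} → Prime p → ¬ 2 ∣ p → ¬ p ∣ m → ¬ p ∣ m * 4
odd-prime∤*4 {p} {m} pp 2∤p p∤m p∣m4 with euclidsLemma m 4 pp p∣m4
... | inj₁ p∣m = p∤m p∣m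
... | inj₂ p∣4 with euclidsLemma 2 2 pp p∣4
...   | inj₁ p∣2 = 2∤p (subst (_∣ p) (prime∣prime⇒≡ pp prime[2] p∣2) ∣-refl)
...   | inj₂ p∣2 = 2∤p (subst (_∣ p) (prime∣prime⇒≡ pp prime[2] p∣2) ∣-refl)

primewise-anisotropic-*-prime : ∀ {p m w} → Prime p → ¬ 2 ∣ p → ¬ p ∣ m →
  PrimewiseAnisotropic m (1 + w * 4) → ∃ λ w′ → PrimewiseAnisotropic (p * m) (1 + w′ * 4)
primewise-anisotropic-*-prime {p} {m} {w} pp 2∤p p∤m aniso
  with z , aniso-z ← anisotropic-at-odd-prime pp 2∤p
  with y , (j , y≡) , (k , y≡z) ← chinese-remainder (prime⇒>1 pp)
         (coprime-sym (prime∤⇒coprime pp (odd-prime∤*4 pp 2∤p p∤m))) (1 + w * 4) z =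
  w + j * m , aniso′
  where
  regroup : ∀ w j m → 1 + w * 4 + j * (m * 4) ≡ 1 + (w + j * m) * 4
  regroup = solve-∀
  y≡1+w′*4 : y ≡ 1 + (w + j * m) * 4
  y≡1+w′*4 = trans y≡ (regroup w j m)
  aniso′ : PrimewiseAnisotropic (p * m) (1 + (w + j * m) * 4)
  aniso′ qp q∣pm with euclidsLemma p m qp q∣pm
  ... | inj₁ q∣p rewrite prime∣prime⇒≡ qp pp q∣p =
    anisotropic-transfer k ∣-refl (trans (sym y≡1+w′*4) y≡z) aniso-z
  ... | inj₂ q∣m =
    anisotropic-transfer j (∣m⇒∣m*n 4 q∣m) (trans (sym y≡1+w′*4) y≡) (aniso qp q∣m)

primewise-anisotropic-odd : ∀ {ps} → All Prime ps → ¬ 2 ∣ product ps →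
  ∃ λ w → PrimewiseAnisotropic (product ps) (1 + w * 4)
primewise-anisotropic-odd [] _ = 0 , λ qp q∣1 → contradiction (subst Prime (∣1⇒≡1 q∣1) qp) ¬prime[1]
primewise-anisotropic-odd {p ∷ ps} (pp ∷ psp) 2∤pΠ
  with w , aniso ← primewise-anisotropic-odd psp (λ 2∣Π → 2∤pΠ (∣n⇒∣m*n p 2∣Π))
  with p ∣? product ps
... | yes p∣Π = w , primewise-anisotropic-*-divisor {y = 1 + w * 4} pp p∣Π aniso
... | no p∤Π =
  primewise-anisotropic-*-prime {w = w} pp (λ 2∣p → 2∤pΠ (∣m⇒∣m*n (product ps) 2∣p)) p∤Π aniso

v₂-even⇒4^k*odd : ∀ {n r} → V₂ n r → 2 ∣ r → ∃₂ λ k m → n ≡ 4 ^ k * m × ¬ 2 ∣ m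
v₂-even⇒4^k*odd {n} (divides m n≡m*2^r , 2^r+1∤n) (divides k refl) = k , m , n≡4^k*m , 2∤m
  where
  2^2k≡4^k : 2 ^ (k * 2) ≡ 4 ^ k
  2^2k≡4^k = trans (cong (2 ^_) (*-comm k 2)) (sym (^-*-assoc 2 2 k))
  n≡4^k*m : n ≡ 4 ^ k * m
  n≡4^k*m = trans n≡m*2^r (trans (cong (m *_) 2^2k≡4^k) (*-comm m (4 ^ k)))
  2∤m : ¬ 2 ∣ m
  2∤m (divides m′ refl) = 2^r+1∤n (divides m′ (trans n≡m*2^r (*-assoc m′ 2 _)))

module _ {n′ y : ℕ} (sep : Separating (2+ n′) y) where
  private
    n = 2+ n′

  ȳ : Fin n
  ȳ = fromℕ< (m%n<n y n)

  form-%-reduce : ∀ s t → (s * s % n + y % n * (t * t % n)) % n ≡ form y s t % n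
  form-%-reduce s t = begin
    (s * s % n + y % n * (t * t % n)) % n          ≡⟨ %-distribˡ-+ (s * s % n) _ n ⟩
    (s * s % n % n + y % n * (t * t % n) % n) % n
      ≡⟨ cong (λ u → (u + y % n * (t * t % n) % n) % n) (m%n%n≡m%n (s * s) n) ⟩
    (s * s % n + y % n * (t * t % n) % n) % n
      ≡⟨ cong (λ u → (s * s % n + u) % n) (%-distribˡ-* y (t * t) n) ⟨
    (s * s % n + y * (t * t) % n) % n              ≡⟨ %-distribˡ-+ (s * s) _ n ⟨
    form y s t % n                                 ∎
    where open ≡-Reasoning

  -- Every weighted sum over a nonempty subsequence of (1, ȳ) has this shape, an absent
  -- term having weight B = 0 = 0².
  squares-vanish : ∀ s t {A B} → s * s % n ≡ A → t * t % n ≡ B →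
    (A * 1 + (B * toℕ ȳ + 0)) % n ≡ 0 → A ≡ 0 × B ≡ 0
  squares-vanish s t {A} {B} s²≡A t²≡B sum≡0 =
    trans (sym s²≡A) (n∣m⇒m%n≡0 _ n (proj₁ n∣s²×t²)) ,
    trans (sym t²≡B) (n∣m⇒m%n≡0 _ n (proj₂ n∣s²×t²))
    where
    normalise : ∀ A B Y → A * 1 + (B * Y + 0) ≡ A + Y * B
    normalise = solve-∀
    sum≡form : (A * 1 + (B * toℕ ȳ + 0)) % n ≡ form y s t % n
    sum≡form = begin
      (A * 1 + (B * toℕ ȳ + 0)) % n          ≡⟨ cong (_% n) (normalise A B (toℕ ȳ)) ⟩
      (A + toℕ ȳ * B) % n                    ≡⟨ cong₂ (λ a b → (a + toℕ ȳ * b) % n) s²≡A t²≡B ⟨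
      (s * s % n + toℕ ȳ * (t * t % n)) % n
        ≡⟨ cong (λ z → (s * s % n + z * (t * t % n)) % n) (toℕ-fromℕ< (m%n<n y n)) ⟩
      (s * s % n + y % n * (t * t % n)) % n  ≡⟨ form-%-reduce s t ⟩
      form y s t % n                         ∎
      where open ≡-Reasoning
    n∣s²×t² = sep s t (m%n≡0⇒n∣m _ n (trans (sym sum≡form) sum≡0))

  no-zero-sum-1 : ¬ HasSstarZeroSum n {1} (λ _ → fsuc fzero)
  no-zero-sum-1 (false ∷ [] , (fzero , ()) , _)
  no-zero-sum-1 (true ∷ [] , _ , a , a∈S , sum≡0)
    with (s , s²≡a) , a≢0 ← a∈S fzero here = a≢0 (proj₁ (squares-vanish (toℕ s) 0 s²≡a refl sum≡0))

  pair : Fin 2 → Fin n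
  pair fzero = fsuc fzero
  pair (fsuc fzero) = ȳ

  no-zero-sum-2 : ¬ HasSstarZeroSum n pair
  no-zero-sum-2 (false ∷ false ∷ [] , (fzero , ()) , _)
  no-zero-sum-2 (false ∷ false ∷ [] , (fsuc fzero , there ()) , _)
  no-zero-sum-2 (true ∷ false ∷ [] , _ , a , a∈S , sum≡0)
    with (s , s²≡a) , a≢0 ← a∈S fzero here = a≢0 (proj₁ (squares-vanish (toℕ s) 0 s²≡a refl sum≡0))
  no-zero-sum-2 (false ∷ true ∷ [] , _ , b , b∈S , sum≡0)
    with (t , t²≡b) , b≢0 ← b∈S (fsuc fzero) (there here) =
    b≢0 (proj₂ (squares-vanish 0 (toℕ t) refl t²≡b sum≡0))
  no-zero-sum-2 (true ∷ true ∷ [] , _ , a , a∈S , sum≡0)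
    with (s , s²≡a) , a≢0 ← a∈S fzero here
       | (t , t²≡b) , _ ← a∈S (fsuc fzero) (there here) =
    a≢0 (proj₁ (squares-vanish (toℕ s) (toℕ t) s²≡a t²≡b sum≡0))

  separating⇒D≥3 : DStarAtLeast n 3
  separating⇒D≥3 1 _ has = contradiction (has _) no-zero-sum-1
  separating⇒D≥3 2 _ has = contradiction (has pair) no-zero-sum-2
  separating⇒D≥3 (suc (suc (suc _))) _ _ = s≤s (s≤s (s≤s z≤n))

theorem6 : (n : ℕ) → .{{_ : NonZero n}} → (r : ℕ) → V₂ n r → 2 ≤ r → 2 ∣ r →
    DStarAtLeast n 3
-- 2 ≤ r is used only to exclude n = 1, where 1 = 0 in ℤ_n.
theorem6 1 (suc r′) (2^r∣1 , _) _ _ =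
  contradiction (∣1⇒≡1 (∣-trans (m∣m*n {2} (2 ^ r′)) 2^r∣1)) λ ()
theorem6 n@(2+ _) r v₂ _ 2∣r
  with k , m , n≡4^k*m , 2∤m ← v₂-even⇒4^k*odd v₂ 2∣r
  with record { factors = ps ; isFactorisation = m≡Πps ; factorsPrime = psp }
         ← factorise m {{m*n≢0⇒n≢0 (4 ^ k) {{subst NonZero n≡4^k*m _}}}}
  with w , aniso ← primewise-anisotropic-odd psp (subst (λ m → ¬ 2 ∣ m) m≡Πps 2∤m) =
  separating⇒D≥3 {y = 1 + w * 4} (subst (λ n → Separating n (1 + w * 4)) 4^k*Πps≡n
    (separating-4^* k w
      (primewise-anisotropic⇒separating {1 + w * 4} (product ps) (productOfPrimes≢0 psp) aniso)))
  where
  4^k*Πps≡n : 4 ^ k * product ps ≡ n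
  4^k*Πps≡n = sym (trans n≡4^k*m (cong (4 ^ k *_) m≡Πps))
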